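{- (1) For every odd $n\ge 3$ there is a tight irreducible subcube partition $F$ of $\{0,1\}^n$ with $\delta(F)=\frac{n-3}{2}$. (2) For $n=4$ there is a tight irreducible subcube partition $F$ of $\{0,1\}^4$ with $\delta(F)=0$. (3) For every even $n\ge 6$ there is a tight irreducible subcube partition $F$ of $\{0,1\}^n$ with $\delta(F)=\frac{n-2}{2}$.
   Context: Subcubes of $\{0,1\}^n$ are identified with words in $\{0,1,*\}^n$; the dimension of a subcube is its number of $*$s. A subcube partition is a partition of $\{0,1\}^n$ into subcubes; it is irreducible if no subset $G$ with $1<|G|<|F|$ has a union that is a subcube, and tight if for every coordinate $i$ some subcube $s$ has $s_i\ne*$. $\delta(F)$ denotes the minimum dimension of a subcube in $F$. -}

module Defs where

open import Data.Nat using (ℕ; zero; suc; _<_; _≤_)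
open import Data.Bool using (Bool; true; false)
open import Data.Vec using (Vec; []; _∷_; lookup)
open import Data.List using (List; length)
import Data.List as L
open import Data.Fin using (Fin)
open import Data.Fin.Subset using (Subset; ∣_∣)
import Data.Fin.Subset as S
open import Data.Product using (Σ; ∃; _×_)
open import Relation.Binary.PropositionalEquality using (_≡_; _≢_)
open import Relation.Nullary using (¬_)
open import Function.Bundles using (_⇔_)

data Sym : Set where
  𝟎 𝟏 ⋆ : Sym

Subcube : ℕ → Set
Subcube n = Vec Sym n

Point : ℕ → Set
Point n = Vec Bool n

data Matches : Sym → Bool → Set where
  m0 : Matches 𝟎 false
  m1 : Matches 𝟏 true
  m⋆ : ∀ {b} → Matches ⋆ b

_∈c_ : ∀ {n} → Point n → Subcube n → Set
_∈c_ {n} x s = (i : Fin n) → Matches (lookup s i) (lookup x i)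

dim : ∀ {n} → Subcube n → ℕ
dim [] = 0
dim (⋆ ∷ s) = suc (dim s)
dim (𝟎 ∷ s) = dim s
dim (𝟏 ∷ s) = dim s

Family : ℕ → Set
Family n = List (Subcube n)

member : ∀ {n} (F : Family n) → Fin (length F) → Subcube n
member F j = L.lookup F j

IsSubcubePartition : ∀ {n} → Family n → Set
IsSubcubePartition {n} F =
  ((x : Point n) → ∃ λ j → x ∈c member F j) ×
  ((x : Point n) (j k : Fin (length F)) → x ∈c member F j → x ∈c member F k → j ≡ k)

UnionIs : ∀ {n} (F : Family n) → Subset (length F) → Subcube n → Set
UnionIs {n} F G s =
  (x : Point n) → (x ∈c s) ⇔ (∃ λ j → (j S.∈ G) × (x ∈c member F j))

Irreducible : ∀ {n} → Family n → Set
Irreducible {n} F =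
  (G : Subset (length F)) → 1 < ∣ G ∣ → ∣ G ∣ < length F →
  ¬ (∃ λ (s : Subcube n) → UnionIs F G s)

Tight : ∀ {n} → Family n → Set
Tight {n} F = (i : Fin n) → ∃ λ j → lookup (member F j) i ≢ ⋆

δ≡ : ∀ {n} → Family n → ℕ → Set
δ≡ F d = (∃ λ j → dim (member F j) ≡ d) × (∀ j → d ≤ dim (member F j))

module Submission where

-- Call two disjoint subcubes U, V a switch if their union is also the disjoint union of a
-- differently split pair X, Y: U, V differ in a coordinate i, while X, Y differ in a coordinate j.
-- Suppose a tight irreducible partition of {0,1}^n contains two switches (U_A, V_A), (U_B, V_B).
-- Add two coordinates y, z: every other member gets ⋆⋆ in front, over y = 0 the members U_A, V_A
-- are kept and over y = 1 they are replaced by X_A, Y_A, and likewise for the B-switch along z.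
-- This is again a tight partition, every dimension grows by at least one, and 0⋆U_A, 0⋆V_A and
-- ⋆0U_B, ⋆0V_B are again switches, so the step can be iterated. Irreducibility survives. A union
-- of members that fixes y or z can only contain the two members over one value of one coordinate;
-- containing both would make its restriction a union of old members containing U, V of one switch
-- but missing the other switch. A union of members leaving y and z free restricts to a union s of
-- old members; if s contains at most one old member, no member built from a switch lies in s,
-- since any of them would force both U and V of that switch into s.
-- Iterating from explicit partitions for n = 3 (δ = 0) and n = 6 (δ = 2) gives all odd n ≥ 3 and
-- all even n ≥ 6; these base cases and n = 4 are checked by exhaustive computation.

open import Defs
open import Data.Nat using (ℕ; zero; suc; _+_; _*_; _≤_; z≤n; s≤s)
open import Data.Nat.Properties using (<⇒≱; ≤-trans; m≤n⇒m≤1+n; *-comm; +-identityʳ)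
import Data.Nat as ℕ
open import Data.Bool using (Bool; true; false; not)
open import Data.Vec using (Vec; []; _∷_; lookup; _[_]≔_)
open import Data.Vec.Properties using (lookup∘update; lookup∘update′)
open import Data.Vec.Relation.Binary.Pointwise.Inductive as Pointwise using (Pointwise; []; _∷_)
open import Data.List as List using (List; []; _∷_; _++_; length; cartesianProductWith)
open import Data.List.Membership.Propositional using (_∈_; find; lose)
open import Data.List.Membership.Propositional.Properties using (∈-lookup; ∈-cartesianProductWith⁺; ∈-map⁺; ∈-map⁻)
open import Data.List.Relation.Unary.Any as Any using (Any; here; there)
import Data.List.Relation.Unary.Any.Properties as Anyₚ
open Anyₚ using (lookup-index)
open import Data.List.Relation.Unary.All as All using (All; []; _∷_)
import Data.List.Relation.Unary.All.Properties as Allₚ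
open import Data.List.Relation.Unary.AllPairs as AllPairs using (AllPairs; []; _∷_)
import Data.List.Relation.Unary.AllPairs.Properties as AllPairsₚ
open import Data.Fin using (Fin; zero; suc; #_)
import Data.Fin.Properties as Fin
open import Data.Fin.Subset using (Subset; ∣_∣; ⊤; ⁅_⁆)
import Data.Fin.Subset as Subset
open import Data.Fin.Subset.Properties using (_∈?_; nonempty?; p⊆q⇒∣p∣≤∣q∣; ∣⊤∣≡n; ∣⁅x⁆∣≡1; x∈⁅x⁆; ∣⊥∣≡0)
open import Data.Product using (∃; ∃₂; _×_; _,_; proj₁; proj₂)
open import Data.Sum as Sum using (_⊎_; inj₁; inj₂)
open import Data.Empty using (⊥; ⊥-elim)
open import Function using (_∘_; id)
open import Function.Bundles using (Equivalence)
open import Relation.Binary.PropositionalEquality using (_≡_; _≢_; refl; sym; trans; cong; subst; subst₂)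
open import Relation.Nullary using (¬_; Dec; yes; no; ¬?)
open import Relation.Nullary.Decidable using (True; toWitness; _×-dec_; _⊎-dec_; _→-dec_)
open import Relation.Binary.Definitions using (Decidable)

vectors : ∀ {A : Set} → List A → (n : ℕ) → List (Vec A n)
vectors as zero    = [] ∷ []
vectors as (suc n) = cartesianProductWith _∷_ as (vectors as n)

∈-vectors : ∀ {A : Set} {as : List A} → (∀ a → a ∈ as) → ∀ {n} (v : Vec A n) → v ∈ vectors as n
∈-vectors every []      = here refl
∈-vectors every (a ∷ v) = ∈-cartesianProductWith⁺ _∷_ (every a) (∈-vectors every v)

AllPairs-++⁻ : ∀ {A : Set} {R : A → A → Set} xs {ys} → AllPairs R (xs ++ ys) →
               AllPairs R xs × AllPairs R ys × All (λ x → All (R x) ys) xs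
AllPairs-++⁻ []       p       = [] , p , []
AllPairs-++⁻ (x ∷ xs) (h ∷ p) with Allₚ.++⁻ xs h | AllPairs-++⁻ xs p
... | hxs , hys | pxs , pys , cross = hxs ∷ pxs , pys , hys ∷ cross

AllPairs-lookup : ∀ {A : Set} {R : A → A → Set} {xs} → AllPairs R xs → ∀ j k →
                  j ≡ k ⊎ R (List.lookup xs j) (List.lookup xs k) ⊎ R (List.lookup xs k) (List.lookup xs j)
AllPairs-lookup (_ ∷ _) zero    zero    = inj₁ refl
AllPairs-lookup (h ∷ _) zero    (suc k) = inj₂ (inj₁ (All.lookup h (∈-lookup k)))
AllPairs-lookup (h ∷ _) (suc j) zero    = inj₂ (inj₂ (All.lookup h (∈-lookup j)))
AllPairs-lookup (_ ∷ p) (suc j) (suc k) with AllPairs-lookup p j k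
... | inj₁ refl = inj₁ refl
... | inj₂ r    = inj₂ r

AllPairs-∈ : ∀ {A : Set} {R : A → A → Set} {xs x y} → AllPairs R xs → x ∈ xs → y ∈ xs →
             x ≡ y ⊎ R x y ⊎ R y x
AllPairs-∈ _       (here refl) (here refl) = inj₁ refl
AllPairs-∈ (h ∷ _) (here refl) (there m)   = inj₂ (inj₁ (All.lookup h m))
AllPairs-∈ (h ∷ _) (there m)   (here refl) = inj₂ (inj₂ (All.lookup h m))
AllPairs-∈ (_ ∷ p) (there m)   (there m′)  = AllPairs-∈ p m m′

∣p∣≤1 : ∀ {m} {p : Subset m} → (∀ {x y} → x Subset.∈ p → y Subset.∈ p → x ≡ y) → ∣ p ∣ ≤ 1
∣p∣≤1 {m} {p} unique with nonempty? p
... | yes (x , x∈p) = subst (∣ p ∣ ≤_) (∣⁅x⁆∣≡1 x)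
                        (p⊆q⇒∣p∣≤∣q∣ λ y∈p → subst (Subset._∈ ⁅ x ⁆) (unique x∈p y∈p) (x∈⁅x⁆ x))
... | no  empty     = ≤-trans (subst (∣ p ∣ ≤_) (∣⊥∣≡0 m)
                        (p⊆q⇒∣p∣≤∣q∣ {q = Subset.⊥} λ y∈p → ⊥-elim (empty (_ , y∈p)))) z≤n

infix 4 _⊑_ _⊆ᶜ_ _∈ᶜ_

data _⊑_ : Sym → Sym → Set where
  𝟎⊑𝟎 : 𝟎 ⊑ 𝟎
  𝟏⊑𝟏 : 𝟏 ⊑ 𝟏
  ⊑⋆  : ∀ {α} → α ⊑ ⋆

⊑-refl : ∀ {α} → α ⊑ α
⊑-refl {𝟎} = 𝟎⊑𝟎
⊑-refl {𝟏} = 𝟏⊑𝟏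
⊑-refl {⋆} = ⊑⋆

_⊑?_ : Decidable _⊑_
𝟎 ⊑? 𝟎 = yes 𝟎⊑𝟎
𝟎 ⊑? 𝟏 = no λ ()
𝟏 ⊑? 𝟎 = no λ ()
𝟏 ⊑? 𝟏 = yes 𝟏⊑𝟏
⋆ ⊑? 𝟎 = no λ ()
⋆ ⊑? 𝟏 = no λ ()
_ ⊑? ⋆ = yes ⊑⋆

⊑-matches : ∀ {α γ b} → α ⊑ γ → Matches α b → Matches γ b
⊑-matches 𝟎⊑𝟎 m = m
⊑-matches 𝟏⊑𝟏 m = m
⊑-matches ⊑⋆  _ = m⋆

⊑-complete : ∀ {α γ} → (∀ {b} → Matches α b → Matches γ b) → α ⊑ γ
⊑-complete {𝟎} {𝟎} _ = 𝟎⊑𝟎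
⊑-complete {𝟏} {𝟏} _ = 𝟏⊑𝟏
⊑-complete {_} {⋆} _ = ⊑⋆
⊑-complete {𝟎} {𝟏} h with h m0
... | ()
⊑-complete {𝟏} {𝟎} h with h m1
... | ()
⊑-complete {⋆} {𝟎} h with h {true} m⋆
... | ()
⊑-complete {⋆} {𝟏} h with h {false} m⋆
... | ()

Overlap : Sym → Sym → Set
Overlap α β = ∃ λ b → Matches α b × Matches β b

overlap? : Decidable Overlap
overlap? 𝟎 𝟏 = no λ { (false , _ , ()) ; (true , () , _) }
overlap? 𝟏 𝟎 = no λ { (false , () , _) ; (true , _ , ()) }
overlap? 𝟎 𝟎 = yes (false , m0 , m0)
overlap? 𝟏 𝟏 = yes (true , m1 , m1)
overlap? 𝟎 ⋆ = yes (false , m0 , m⋆)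
overlap? 𝟏 ⋆ = yes (true , m1 , m⋆)
overlap? ⋆ 𝟎 = yes (false , m⋆ , m0)
overlap? ⋆ 𝟏 = yes (true , m⋆ , m1)
overlap? ⋆ ⋆ = yes (false , m⋆ , m⋆)

matches? : ∀ α b → Dec (Matches α b)
matches? 𝟎 false = yes m0
matches? 𝟎 true  = no λ ()
matches? 𝟏 false = no λ ()
matches? 𝟏 true  = yes m1
matches? ⋆ _     = yes m⋆

_≟⋆ : (α : Sym) → Dec (α ≡ ⋆)
𝟎 ≟⋆ = no λ ()
𝟏 ≟⋆ = no λ ()
⋆ ≟⋆ = yes refl

bit : Bool → Sym
bit false = 𝟎
bit true  = 𝟏

matches-bit⊎not : ∀ a x → Matches (bit a) x ⊎ Matches (bit (not a)) x
matches-bit⊎not false false = inj₁ m0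
matches-bit⊎not false true  = inj₂ m1
matches-bit⊎not true  false = inj₂ m0
matches-bit⊎not true  true  = inj₁ m1

matches-bit-not : ∀ {a x} → Matches (bit a) x → ¬ Matches (bit (not a)) x
matches-bit-not {false} m0 ()
matches-bit-not {true}  m1 ()

pick : Sym → Bool
pick 𝟏 = true
pick _ = false

matches-pick : ∀ α → Matches α (pick α)
matches-pick 𝟎 = m0
matches-pick 𝟏 = m1
matches-pick ⋆ = m⋆

⋆-overlap : ∀ α → Overlap ⋆ α
⋆-overlap α = pick α , m⋆ , matches-pick α

overlap-⋆ : ∀ α → Overlap α ⋆
overlap-⋆ α = pick α , matches-pick α , m⋆

⋆⋢bit : ∀ y → ¬ ⋆ ⊑ bit y
⋆⋢bit false ()
⋆⋢bit true  ()

_∈ᶜ_ : ∀ {n} → Point n → Subcube n → Set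
x ∈ᶜ c = Pointwise Matches c x

∈c⇒∈ᶜ : ∀ {n} {c : Subcube n} x → x ∈c c → x ∈ᶜ c
∈c⇒∈ᶜ {c = []}    []      _ = []
∈c⇒∈ᶜ {c = _ ∷ _} (_ ∷ x) h = h zero ∷ ∈c⇒∈ᶜ x (h ∘ suc)

∈ᶜ⇒∈c : ∀ {n} {x : Point n} {c} → x ∈ᶜ c → x ∈c c
∈ᶜ⇒∈c = Pointwise.lookup

corner : ∀ {n} → Subcube n → Point n
corner []      = []
corner (α ∷ c) = pick α ∷ corner c

corner-∈ᶜ : ∀ {n} (c : Subcube n) → corner c ∈ᶜ c
corner-∈ᶜ []      = []
corner-∈ᶜ (α ∷ c) = matches-pick α ∷ corner-∈ᶜ c

_⊆ᶜ_ : ∀ {n} → Subcube n → Subcube n → Set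
_⊆ᶜ_ = Pointwise _⊑_

⊆ᶜ-sound : ∀ {n} {c s : Subcube n} {x} → c ⊆ᶜ s → x ∈ᶜ c → x ∈ᶜ s
⊆ᶜ-sound []       []       = []
⊆ᶜ-sound (p ∷ ps) (m ∷ ms) = ⊑-matches p m ∷ ⊆ᶜ-sound ps ms

⊆ᶜ-complete : ∀ {n} {c s : Subcube n} → (∀ {x} → x ∈ᶜ c → x ∈ᶜ s) → c ⊆ᶜ s
⊆ᶜ-complete {c = []}    {[]}    _ = []
⊆ᶜ-complete {c = α ∷ c} {_ ∷ _} h =
  ⊑-complete (λ m → Pointwise.head (h (m ∷ corner-∈ᶜ c))) ∷
  ⊆ᶜ-complete (λ ms → Pointwise.tail (h (matches-pick α ∷ ms)))

Disjoint : ∀ {n} → Subcube n → Subcube n → Set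
Disjoint c s = ¬ Pointwise Overlap c s

disjoint? : ∀ {n} (c s : Subcube n) → Dec (Disjoint c s)
disjoint? c s = ¬? (Pointwise.decidable overlap? c s)

_∈ᶜ?_ : ∀ {n} (x : Point n) (c : Subcube n) → Dec (x ∈ᶜ c)
x ∈ᶜ? c = Pointwise.decidable matches? c x

_⊆ᶜ?_ : ∀ {n} (c s : Subcube n) → Dec (c ⊆ᶜ s)
_⊆ᶜ?_ = Pointwise.decidable _⊑?_

common⇒overlap : ∀ {n} {c s : Subcube n} {x} → x ∈ᶜ c → x ∈ᶜ s → Pointwise Overlap c s
common⇒overlap []       []         = []
common⇒overlap (m ∷ ms) (m′ ∷ ms′) = (_ , m , m′) ∷ common⇒overlap ms ms′

overlap⇒common : ∀ {n} {c s : Subcube n} → Pointwise Overlap c s → ∃ λ x → x ∈ᶜ c × x ∈ᶜ s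
overlap⇒common []                 = [] , [] , []
overlap⇒common ((b , m , m′) ∷ o) with overlap⇒common o
... | x , ms , ms′ = b ∷ x , m ∷ ms , m′ ∷ ms′

Disjoint-sound : ∀ {n} {c s : Subcube n} {x} → Disjoint c s → x ∈ᶜ c → ¬ x ∈ᶜ s
Disjoint-sound d m m′ = d (common⇒overlap m m′)

Disjoint-complete : ∀ {n} {c s : Subcube n} → (∀ {x} → x ∈ᶜ c → ¬ x ∈ᶜ s) → Disjoint c s
Disjoint-complete h o with overlap⇒common o
... | _ , m , m′ = h m m′

Disjoint-sym : ∀ {n} {c s : Subcube n} → Disjoint c s → Disjoint s c
Disjoint-sym d = Disjoint-complete λ m m′ → Disjoint-sound d m′ m

⊆ᶜ⇒¬Disjoint : ∀ {n} {c s : Subcube n} → c ⊆ᶜ s → ¬ Disjoint c s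
⊆ᶜ⇒¬Disjoint {c = c} p d = Disjoint-sound d (corner-∈ᶜ c) (⊆ᶜ-sound p (corner-∈ᶜ c))

Disjoint⇒≢ : ∀ {n} {c s : Subcube n} → Disjoint c s → c ≢ s
Disjoint⇒≢ {c = c} d refl = Disjoint-sound d (corner-∈ᶜ c) (corner-∈ᶜ c)

⊆ᶜ-trans : ∀ {n} {c s t : Subcube n} → c ⊆ᶜ s → s ⊆ᶜ t → c ⊆ᶜ t
⊆ᶜ-trans p q = ⊆ᶜ-complete (⊆ᶜ-sound q ∘ ⊆ᶜ-sound p)

∷²-disjoint : ∀ {n γ δ γ′ δ′} {c s : Subcube n} → Disjoint c s → Disjoint (γ ∷ δ ∷ c) (γ′ ∷ δ′ ∷ s)
∷²-disjoint d = d ∘ Pointwise.tail ∘ Pointwise.tail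

∷-disjoint⁻ : ∀ {n γ α} {c s : Subcube n} → Overlap γ α → Disjoint (γ ∷ c) (α ∷ s) → Disjoint c s
∷-disjoint⁻ o d = d ∘ (o ∷_)

_⊆_∪_ : ∀ {n} → Subcube n → Subcube n → Subcube n → Set
c ⊆ s ∪ t = ∀ {x} → x ∈ᶜ c → x ∈ᶜ s ⊎ x ∈ᶜ t

∪-⊆ᶜ : ∀ {n} {c s t r : Subcube n} → c ⊆ s ∪ t → s ⊆ᶜ r → t ⊆ᶜ r → c ⊆ᶜ r
∪-⊆ᶜ cover ps pt = ⊆ᶜ-complete λ m → Sum.[ ⊆ᶜ-sound ps , ⊆ᶜ-sound pt ] (cover m)

Saturated : ∀ {n} → Family n → Subcube n → Set
Saturated F s = All (λ c → c ⊆ᶜ s ⊎ Disjoint c s) F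

AtMostOneInside : ∀ {n} → Family n → Subcube n → Set
AtMostOneInside F s = ∀ {c c′} → c ∈ F → c′ ∈ F → c ⊆ᶜ s → c′ ⊆ᶜ s → c ≡ c′

-- In a partition the unions of members are exactly the saturated subcubes, so this is irreducibility.
IrreducibleIn : ∀ {n} → Family n → Set
IrreducibleIn {n} F = (s : Subcube n) → Saturated F s → All (_⊆ᶜ s) F ⊎ AtMostOneInside F s

record TightIrreduciblePartition {n} (F : Family n) (d : ℕ) : Set where
  field
    covers      : ∀ x → Any (x ∈ᶜ_) F
    disjoint    : AllPairs Disjoint F
    irreducible : IrreducibleIn F
    tight       : ∀ k → Any (λ c → lookup c k ≢ ⋆) F
    minimal     : Any (λ c → dim c ≡ d) F
    dim≥        : All (λ c → d ≤ dim c) F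

saturated-inside : ∀ {n} {G : Family n} {t c x} → Saturated G t → c ∈ G → x ∈ᶜ c → x ∈ᶜ t → c ⊆ᶜ t
saturated-inside sat c∈G m m′ = Sum.[ id , (λ d → ⊥-elim (Disjoint-sound d m m′)) ] (All.lookup sat c∈G)

saturated-outside : ∀ {n} {G : Family n} {t c} → Saturated G t → c ∈ G → ¬ c ⊆ᶜ t → Disjoint c t
saturated-outside sat c∈G ¬p = Sum.[ ⊥-elim ∘ ¬p , id ] (All.lookup sat c∈G)

two-inside-one-outside : ∀ {n} {G : Family n} {t c c′ e} → IrreducibleIn G → Saturated G t →
                         c ∈ G → c′ ∈ G → e ∈ G → c ≢ c′ → c ⊆ᶜ t → c′ ⊆ᶜ t → ¬ Disjoint e t
two-inside-one-outside irr sat c∈G c′∈G e∈G c≢c′ p p′ d with irr _ sat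
... | inj₁ all = ⊆ᶜ⇒¬Disjoint (All.lookup all e∈G) d
... | inj₂ one = c≢c′ (one c∈G c′∈G p p′)

at-most-one-of : ∀ {n} {G : Family n} {t P Q} → (∀ {c} → c ∈ G → c ⊆ᶜ t → c ≡ P ⊎ c ≡ Q) →
                 ¬ (P ⊆ᶜ t × Q ⊆ᶜ t) → AtMostOneInside G t
at-most-one-of only ¬both c∈G c′∈G p p′ with only c∈G p | only c′∈G p′
... | inj₁ refl | inj₁ refl = refl
... | inj₁ refl | inj₂ refl = ⊥-elim (¬both (p , p′))
... | inj₂ refl | inj₁ refl = ⊥-elim (¬both (p′ , p))
... | inj₂ refl | inj₂ refl = refl

module _ {n} {F : Family n} {d} (P : TightIrreduciblePartition F d) where
  open TightIrreduciblePartition P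

  member-unique : ∀ {x} j k → x ∈ᶜ member F j → x ∈ᶜ member F k → j ≡ k
  member-unique j k m m′ with AllPairs-lookup disjoint j k
  ... | inj₁ j≡k         = j≡k
  ... | inj₂ (inj₁ djk) = ⊥-elim (Disjoint-sound djk m m′)
  ... | inj₂ (inj₂ dkj) = ⊥-elim (Disjoint-sound dkj m′ m)

  isPartition : IsSubcubePartition F
  isPartition = (λ x → Any.index (covers x) , ∈ᶜ⇒∈c (lookup-index (covers x)))
              , λ x j k m m′ → member-unique j k (∈c⇒∈ᶜ x m) (∈c⇒∈ᶜ x m′)

  module _ (G : Subset (length F)) {s} (union : UnionIs F G s) where
    private
      to : ∀ {x} → x ∈ᶜ s → ∃ λ k → k Subset.∈ G × x ∈ᶜ member F k
      to {x} m with Equivalence.to (union x) (∈ᶜ⇒∈c m)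
      ... | k , k∈G , mk = k , k∈G , ∈c⇒∈ᶜ x mk

    member⊆union : ∀ {j} → j Subset.∈ G → member F j ⊆ᶜ s
    member⊆union j∈G = ⊆ᶜ-complete λ {x} m → ∈c⇒∈ᶜ x (Equivalence.from (union x) (_ , j∈G , ∈ᶜ⇒∈c m))

    meets-union⇒∈ : ∀ j {x} → x ∈ᶜ member F j → x ∈ᶜ s → j Subset.∈ G
    meets-union⇒∈ j m m′ with to m′
    ... | k , k∈G , mk = subst (Subset._∈ G) (sym (member-unique j k m mk)) k∈G

    union-saturated : Saturated F s
    union-saturated = All.tabulate λ c∈F →
      subst (λ c → c ⊆ᶜ s ⊎ Disjoint c s) (sym (lookup-index c∈F)) (classify (Any.index c∈F))
      where
      classify : ∀ j → member F j ⊆ᶜ s ⊎ Disjoint (member F j) s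
      classify j with j ∈? G
      ... | yes j∈G = inj₁ (member⊆union j∈G)
      ... | no  j∉G = inj₂ (Disjoint-complete λ m m′ → j∉G (meets-union⇒∈ j m m′))

  isIrreducible : Irreducible F
  isIrreducible G 1<∣G∣ ∣G∣<∣F∣ (s , union) with irreducible s (union-saturated G union)
  ... | inj₁ all = <⇒≱ ∣G∣<∣F∣ (subst (_≤ ∣ G ∣) (∣⊤∣≡n _) (p⊆q⇒∣p∣≤∣q∣ ⊤⊆G))
    where
    ⊤⊆G : ⊤ Subset.⊆ G
    ⊤⊆G {j} _ = meets-union⇒∈ G union j (corner-∈ᶜ _)
                  (⊆ᶜ-sound (All.lookup all (∈-lookup j)) (corner-∈ᶜ _))
  ... | inj₂ one = <⇒≱ 1<∣G∣ (∣p∣≤1 λ {j} {k} j∈G k∈G → member-unique j k (corner-∈ᶜ _)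
                     (subst (corner (member F j) ∈ᶜ_)
                            (one (∈-lookup j) (∈-lookup k)
                                 (member⊆union G union j∈G) (member⊆union G union k∈G))
                            (corner-∈ᶜ _)))

  isTight : Tight F
  isTight k = Any.index (tight k) , lookup-index (tight k)

  hasδ : δ≡ F d
  hasδ = (Any.index minimal , lookup-index minimal) , λ j → All.lookup dim≥ (∈-lookup j)

realise : ∀ {n d} {F : Family n} → TightIrreduciblePartition F d →
          ∃ λ (F : Family n) → IsSubcubePartition F × Irreducible F × Tight F × δ≡ F d
realise {F = F} P = F , isPartition P , isIrreducible P , isTight P , hasδ P

-- Exhaustive checking of explicit families

bits : List Bool
bits = false ∷ true ∷ []

∈-bits : ∀ b → b ∈ bits
∈-bits false = here refl
∈-bits true  = there (here refl)

letters : List Sym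
letters = 𝟎 ∷ 𝟏 ∷ ⋆ ∷ []

∈-letters : ∀ α → α ∈ letters
∈-letters 𝟎 = here refl
∈-letters 𝟏 = there (here refl)
∈-letters ⋆ = there (there (here refl))

module _ {n} (F : Family n) (d : ℕ) where

  private
    NotBothInside : Subcube n → Subcube n → Subcube n → Set
    NotBothInside s c c′ = ¬ (c ⊆ᶜ s × c′ ⊆ᶜ s)

    Certificate : Set
    Certificate = All (λ x → Any (x ∈ᶜ_) F) (vectors bits n)
                × AllPairs Disjoint F
                × All (λ s → Saturated F s → All (_⊆ᶜ s) F ⊎ AllPairs (NotBothInside s) F) (vectors letters n)
                × (∀ k → Any (λ c → lookup c k ≢ ⋆) F)
                × Any (λ c → dim c ≡ d) F
                × All (λ c → d ≤ dim c) F

    certificate? : Dec Certificate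
    certificate? =
      All.all? (λ x → Any.any? (x ∈ᶜ?_) F) _ ×-dec
      AllPairs.allPairs? disjoint? F ×-dec
      All.all? (λ s → All.all? (λ c → c ⊆ᶜ? s ⊎-dec disjoint? c s) F →-dec
                      (All.all? (_⊆ᶜ? s) F ⊎-dec
                       AllPairs.allPairs? (λ c c′ → ¬? (c ⊆ᶜ? s ×-dec c′ ⊆ᶜ? s)) F)) _ ×-dec
      Fin.all? (λ k → Any.any? (λ c → ¬? (lookup c k ≟⋆)) F) ×-dec
      Any.any? (λ c → dim c ℕ.≟ d) F ×-dec
      All.all? (λ c → d ℕ.≤? dim c) F

    certified : Certificate → TightIrreduciblePartition F d
    certified (covers , disjoint , irreducible , tight , minimal , dim≥) = record
      { covers      = λ x → All.lookup covers (∈-vectors ∈-bits x)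
      ; disjoint    = disjoint
      ; irreducible = λ s sat → Sum.map₂ atMostOne (All.lookup irreducible (∈-vectors ∈-letters s) sat)
      ; tight       = tight
      ; minimal     = minimal
      ; dim≥        = dim≥
      }
      where
      atMostOne : ∀ {s} → AllPairs (NotBothInside s) F → AtMostOneInside F s
      atMostOne notBoth c∈F c′∈F p p′ with AllPairs-∈ notBoth c∈F c′∈F
      ... | inj₁ c≡c′       = c≡c′
      ... | inj₂ (inj₁ ¬pp) = ⊥-elim (¬pp (p , p′))
      ... | inj₂ (inj₂ ¬pp) = ⊥-elim (¬pp (p′ , p))

  certify : {True certificate?} → TightIrreduciblePartition F d
  certify {ok} = certified (toWitness ok)

-- Switches

-- U, V split their union along the coordinate i, and X, Y split the same union along j.
record Switch (n : ℕ) : Set where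
  field
    base : Subcube n
    i j  : Fin n
    i≢j  : i ≢ j
    a b  : Bool

  set : Sym → Sym → Subcube n
  set α β = base [ i ]≔ α [ j ]≔ β

  U V X Y : Subcube n
  U = set (bit a) ⋆
  V = set (bit (not a)) (bit b)
  X = set ⋆ (bit b)
  Y = set (bit a) (bit (not b))

module _ {n} (S : Switch n) where
  open Switch S

  private
    lookup-set-j : ∀ α β → lookup (set α β) j ≡ β
    lookup-set-j α β = lookup∘update j (base [ i ]≔ α) β

    lookup-set-i : ∀ α β → lookup (set α β) i ≡ α
    lookup-set-i α β = trans (lookup∘update′ i≢j (base [ i ]≔ α) β) (lookup∘update i base α)

    lookup-set-other : ∀ α β {k} → k ≢ i → k ≢ j → lookup (set α β) k ≡ lookup base k
    lookup-set-other α β k≢i k≢j = trans (lookup∘update′ k≢j (base [ i ]≔ α) β) (lookup∘update′ k≢i base α)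

    ∈-set-i : ∀ {α β x} → x ∈ᶜ set α β → Matches α (lookup x i)
    ∈-set-i {α} {β} m = subst (λ γ → Matches γ _) (lookup-set-i α β) (Pointwise.lookup m i)

    ∈-set-j : ∀ {α β x} → x ∈ᶜ set α β → Matches β (lookup x j)
    ∈-set-j {α} {β} m = subst (λ γ → Matches γ _) (lookup-set-j α β) (Pointwise.lookup m j)

    ∈-reset : ∀ {α β α′ β′ x} → x ∈ᶜ set α β →
              Matches α′ (lookup x i) → Matches β′ (lookup x j) → x ∈ᶜ set α′ β′
    ∈-reset {α} {β} {α′} {β′} {x} m mi mj = ∈c⇒∈ᶜ x at
      where
      at : ∀ k → Matches (lookup (set α′ β′) k) (lookup x k)
      at k with k Fin.≟ j
      ... | yes refl = subst (λ γ → Matches γ _) (sym (lookup-set-j α′ β′)) mj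
      ... | no  k≢j with k Fin.≟ i
      ...   | yes refl = subst (λ γ → Matches γ _) (sym (lookup-set-i α′ β′)) mi
      ...   | no  k≢i = subst (λ γ → Matches γ _)
                          (trans (lookup-set-other α β k≢i k≢j) (sym (lookup-set-other α′ β′ k≢i k≢j)))
                          (Pointwise.lookup m k)

    set-⊆ᶜ : ∀ {α β α′ β′} → α ⊑ α′ → β ⊑ β′ → set α β ⊆ᶜ set α′ β′
    set-⊆ᶜ p q = ⊆ᶜ-complete λ m → ∈-reset m (⊑-matches p (∈-set-i m)) (⊑-matches q (∈-set-j m))

  U-V-disjoint : Disjoint U V
  U-V-disjoint = Disjoint-complete λ m m′ → matches-bit-not (∈-set-i m) (∈-set-i m′)

  X-Y-disjoint : Disjoint X Y
  X-Y-disjoint = Disjoint-complete λ m m′ → matches-bit-not (∈-set-j m) (∈-set-j m′)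

  V⊆X : V ⊆ᶜ X
  V⊆X = set-⊆ᶜ ⊑⋆ ⊑-refl

  Y⊆U : Y ⊆ᶜ U
  Y⊆U = set-⊆ᶜ ⊑-refl ⊑⋆

  X⊆U∪V : X ⊆ U ∪ V
  X⊆U∪V {x} m with matches-bit⊎not a (lookup x i)
  ... | inj₁ mi = inj₁ (∈-reset m mi m⋆)
  ... | inj₂ mi = inj₂ (∈-reset m mi (∈-set-j m))

  Y⊆U∪V : Y ⊆ U ∪ V
  Y⊆U∪V = inj₁ ∘ ⊆ᶜ-sound Y⊆U

  U⊆X∪Y : U ⊆ X ∪ Y
  U⊆X∪Y {x} m with matches-bit⊎not b (lookup x j)
  ... | inj₁ mj = inj₁ (∈-reset m m⋆ mj)
  ... | inj₂ mj = inj₂ (∈-reset m (∈-set-i m) mj)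

  V⊆X∪Y : V ⊆ X ∪ Y
  V⊆X∪Y = inj₁ ∘ ⊆ᶜ-sound V⊆X

  U∩X : ∃ λ x → x ∈ᶜ U × x ∈ᶜ X
  U∩X = corner (set (bit a) (bit b)) , ⊆ᶜ-sound (set-⊆ᶜ ⊑-refl ⊑⋆) (corner-∈ᶜ _)
                                     , ⊆ᶜ-sound (set-⊆ᶜ ⊑⋆ ⊑-refl) (corner-∈ᶜ _)

open Switch using (U; V; X; Y)

-- The lifting step

switches : ∀ {n} → Switch n → Switch n → Family n
switches A B = U A ∷ V A ∷ U B ∷ V B ∷ []

family : ∀ {n} → Family n → Switch n → Switch n → Family n
family D A B = D ++ switches A B

-- After lifting, X and Y of both switches are members with one more ⋆, and the A-switch's V
-- realises the minimal dimension.
record Configuration (n d : ℕ) : Set where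
  field
    others : Family n
    A B    : Switch n
    valid  : TightIrreduciblePartition (family others A B) d
    dim-VA : dim (V A) ≡ d
    dim-XY : All (λ c → d ≤ dim c) (X A ∷ Y A ∷ X B ∷ Y B ∷ [])

shift : ∀ {n} → Sym → Sym → Switch n → Switch (suc (suc n))
shift γ δ S = record
  { base = γ ∷ δ ∷ base
  ; i    = suc (suc i)
  ; j    = suc (suc j)
  ; i≢j  = i≢j ∘ Fin.suc-injective ∘ Fin.suc-injective
  ; a    = a
  ; b    = b
  }
  where open Switch S

pad : ∀ {n} → Subcube n → Subcube (suc (suc n))
pad c = ⋆ ∷ ⋆ ∷ c

module Lift {n d} (C : Configuration n d) where
  open Configuration C
  open TightIrreduciblePartition valid

  F : Family n
  F = family others A B

  A′ B′ : Switch (suc (suc n))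
  A′ = shift 𝟎 ⋆ A
  B′ = shift ⋆ 𝟎 B

  highs : Family (suc (suc n))
  highs = (𝟏 ∷ ⋆ ∷ X A) ∷ (𝟏 ∷ ⋆ ∷ Y A) ∷ (⋆ ∷ 𝟏 ∷ X B) ∷ (⋆ ∷ 𝟏 ∷ Y B) ∷ []

  others′ : Family (suc (suc n))
  others′ = List.map pad others ++ highs

  F′ : Family (suc (suc n))
  F′ = family others′ A′ B′

  data Old : Subcube n → Set where
    other : ∀ {c} → c ∈ others → Old c
    UA : Old (U A)
    VA : Old (V A)
    UB : Old (U B)
    VB : Old (V B)

  old : ∀ {c} → c ∈ F → Old c
  old c∈F with Anyₚ.++⁻ others c∈F
  ... | inj₁ c∈others                          = other c∈others
  ... | inj₂ (here refl)                       = UA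
  ... | inj₂ (there (here refl))               = VA
  ... | inj₂ (there (there (here refl)))       = UB
  ... | inj₂ (there (there (there (here refl)))) = VB

  old-∈ : ∀ {c} → Old c → c ∈ F
  old-∈ (other c∈others) = Anyₚ.++⁺ˡ c∈others
  old-∈ UA = Anyₚ.++⁺ʳ others (here refl)
  old-∈ VA = Anyₚ.++⁺ʳ others (there (here refl))
  old-∈ UB = Anyₚ.++⁺ʳ others (there (there (here refl)))
  old-∈ VB = Anyₚ.++⁺ʳ others (there (there (there (here refl))))

  data New : Subcube (suc (suc n)) → Set where
    other : ∀ {c} → c ∈ others → New (pad c)
    XA : New (𝟏 ∷ ⋆ ∷ X A)
    YA : New (𝟏 ∷ ⋆ ∷ Y A)
    XB : New (⋆ ∷ 𝟏 ∷ X B)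
    YB : New (⋆ ∷ 𝟏 ∷ Y B)
    UA : New (𝟎 ∷ ⋆ ∷ U A)
    VA : New (𝟎 ∷ ⋆ ∷ V A)
    UB : New (⋆ ∷ 𝟎 ∷ U B)
    VB : New (⋆ ∷ 𝟎 ∷ V B)

  new : ∀ {c} → c ∈ F′ → New c
  new c∈F′ with Anyₚ.++⁻ others′ c∈F′
  ... | inj₂ (here refl)                       = UA
  ... | inj₂ (there (here refl))               = VA
  ... | inj₂ (there (there (here refl)))       = UB
  ... | inj₂ (there (there (there (here refl)))) = VB
  ... | inj₁ c∈others′ with Anyₚ.++⁻ (List.map pad others) c∈others′
  ...   | inj₂ (here refl)                       = XA
  ...   | inj₂ (there (here refl))               = YA
  ...   | inj₂ (there (there (here refl)))       = XB
  ...   | inj₂ (there (there (there (here refl)))) = YB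
  ...   | inj₁ c∈padded with ∈-map⁻ pad c∈padded
  ...     | _ , c∈others , refl = other c∈others

  new-∈ : ∀ {c} → New c → c ∈ F′
  new-∈ (other c∈others) = Anyₚ.++⁺ˡ (Anyₚ.++⁺ˡ (∈-map⁺ pad c∈others))
  new-∈ XA = Anyₚ.++⁺ˡ (Anyₚ.++⁺ʳ (List.map pad others) (here refl))
  new-∈ YA = Anyₚ.++⁺ˡ (Anyₚ.++⁺ʳ (List.map pad others) (there (here refl)))
  new-∈ XB = Anyₚ.++⁺ˡ (Anyₚ.++⁺ʳ (List.map pad others) (there (there (here refl))))
  new-∈ YB = Anyₚ.++⁺ˡ (Anyₚ.++⁺ʳ (List.map pad others) (there (there (there (here refl)))))
  new-∈ UA = Anyₚ.++⁺ʳ others′ (here refl)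
  new-∈ VA = Anyₚ.++⁺ʳ others′ (there (here refl))
  new-∈ UB = Anyₚ.++⁺ʳ others′ (there (there (here refl)))
  new-∈ VB = Anyₚ.++⁺ʳ others′ (there (there (there (here refl))))

  lift-old : ∀ {c} → Old c → ∃₂ λ γ δ → New (γ ∷ δ ∷ c)
  lift-old (other c∈others) = _ , _ , other c∈others
  lift-old UA = _ , _ , UA
  lift-old VA = _ , _ , VA
  lift-old UB = _ , _ , UB
  lift-old VB = _ , _ , VB

  covers′ : ∀ x → Any (x ∈ᶜ_) F′
  covers′ (y ∷ z ∷ x) with find (covers x)
  ... | _ , c∈F , x∈c = cover y z (old c∈F) x∈c
    where
    via : ∀ {c p} → New c → p ∈ᶜ c → Any (p ∈ᶜ_) F′
    via c = lose (new-∈ c)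
    cover : ∀ y z {c x} → Old c → x ∈ᶜ c → Any ((y ∷ z ∷ x) ∈ᶜ_) F′
    cover _     _     (other c∈others) m = via (other c∈others) (m⋆ ∷ m⋆ ∷ m)
    cover false _     UA m = via UA (m0 ∷ m⋆ ∷ m)
    cover true  _     UA m = Sum.[ (λ mx → via XA (m1 ∷ m⋆ ∷ mx)) , (λ my → via YA (m1 ∷ m⋆ ∷ my)) ]
                                   (U⊆X∪Y A m)
    cover false _     VA m = via VA (m0 ∷ m⋆ ∷ m)
    cover true  _     VA m = via XA (m1 ∷ m⋆ ∷ ⊆ᶜ-sound (V⊆X A) m)
    cover _     false UB m = via UB (m⋆ ∷ m0 ∷ m)
    cover _     true  UB m = Sum.[ (λ mx → via XB (m⋆ ∷ m1 ∷ mx)) , (λ my → via YB (m⋆ ∷ m1 ∷ my)) ]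
                                   (U⊆X∪Y B m)
    cover _     false VB m = via VB (m⋆ ∷ m0 ∷ m)
    cover _     true  VB m = via XB (m⋆ ∷ m1 ∷ ⊆ᶜ-sound (V⊆X B) m)

  tight′ : ∀ k → Any (λ c → lookup c k ≢ ⋆) F′
  tight′ zero          = lose (new-∈ UA) λ ()
  tight′ (suc zero)    = lose (new-∈ UB) λ ()
  tight′ (suc (suc k)) with find (tight k)
  ... | _ , c∈F , fixed = lose (new-∈ (proj₂ (proj₂ (lift-old (old c∈F))))) fixed

  dim≥′ : All (λ c → suc d ≤ dim c) F′
  dim≥′ = All.tabulate (bound ∘ new)
    where
    old-bound : ∀ {c} → Old c → d ≤ dim c
    old-bound = All.lookup dim≥ ∘ old-∈
    bound : ∀ {c} → New c → suc d ≤ dim c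
    bound (other c∈others) = s≤s (m≤n⇒m≤1+n (old-bound (other c∈others)))
    bound XA = s≤s (All.lookup dim-XY (here refl))
    bound YA = s≤s (All.lookup dim-XY (there (here refl)))
    bound XB = s≤s (All.lookup dim-XY (there (there (here refl))))
    bound YB = s≤s (All.lookup dim-XY (there (there (there (here refl)))))
    bound UA = s≤s (old-bound UA)
    bound VA = s≤s (old-bound VA)
    bound UB = s≤s (old-bound UB)
    bound VB = s≤s (old-bound VB)

  private
    old-disjoint : AllPairs Disjoint others × AllPairs Disjoint (switches A B) ×
                   All (λ c → All (Disjoint c) (switches A B)) others
    old-disjoint = AllPairs-++⁻ others disjoint

  A⊥B : ∀ {x} → x ∈ᶜ U A ⊎ x ∈ᶜ V A → ¬ (x ∈ᶜ U B ⊎ x ∈ᶜ V B)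
  A⊥B with proj₁ (proj₂ old-disjoint)
  ... | (_ ∷ uu ∷ uv ∷ []) ∷ (vu ∷ vv ∷ []) ∷ _ = λ where
    (inj₁ u) (inj₁ u′) → Disjoint-sound uu u u′
    (inj₁ u) (inj₂ v′) → Disjoint-sound uv u v′
    (inj₂ v) (inj₁ u′) → Disjoint-sound vu v u′
    (inj₂ v) (inj₂ v′) → Disjoint-sound vv v v′

  A-B-disjoint : ∀ {c c′ γ δ γ′ δ′} → c ⊆ U A ∪ V A → c′ ⊆ U B ∪ V B → Disjoint (γ ∷ δ ∷ c) (γ′ ∷ δ′ ∷ c′)
  A-B-disjoint p q = ∷²-disjoint (Disjoint-complete λ m m′ → A⊥B (p m) (q m′))

  B-A-disjoint : ∀ {c c′ γ δ γ′ δ′} → c ⊆ U B ∪ V B → c′ ⊆ U A ∪ V A → Disjoint (γ ∷ δ ∷ c) (γ′ ∷ δ′ ∷ c′)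
  B-A-disjoint p q = Disjoint-sym (A-B-disjoint q p)

  other-A-disjoint : ∀ {c c′ γ δ} → c ∈ others → c′ ⊆ U A ∪ V A → Disjoint (pad c) (γ ∷ δ ∷ c′)
  other-A-disjoint c∈others p with All.lookup (proj₂ (proj₂ old-disjoint)) c∈others
  ... | dU ∷ dV ∷ _ = ∷²-disjoint (Disjoint-complete λ m m′ →
    Sum.[ Disjoint-sound dU m , Disjoint-sound dV m ] (p m′))

  other-B-disjoint : ∀ {c c′ γ δ} → c ∈ others → c′ ⊆ U B ∪ V B → Disjoint (pad c) (γ ∷ δ ∷ c′)
  other-B-disjoint c∈others p with All.lookup (proj₂ (proj₂ old-disjoint)) c∈others
  ... | _ ∷ _ ∷ dU ∷ dV ∷ _ = ∷²-disjoint (Disjoint-complete λ m m′ →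
    Sum.[ Disjoint-sound dU m , Disjoint-sound dV m ] (p m′))

  disjoint′ : AllPairs Disjoint F′
  disjoint′ = AllPairsₚ.++⁺ (AllPairsₚ.++⁺ padded high padded-high) low (Allₚ.++⁺ padded-low high-low)
    where
    padded : AllPairs Disjoint (List.map pad others)
    padded = AllPairsₚ.map⁺ (AllPairs.map ∷²-disjoint (proj₁ old-disjoint))
    high : AllPairs Disjoint highs
    high = (∷²-disjoint (X-Y-disjoint A)
             ∷ A-B-disjoint (X⊆U∪V A) (X⊆U∪V B) ∷ A-B-disjoint (X⊆U∪V A) (Y⊆U∪V B) ∷ [])
         ∷ (A-B-disjoint (Y⊆U∪V A) (X⊆U∪V B) ∷ A-B-disjoint (Y⊆U∪V A) (Y⊆U∪V B) ∷ [])
         ∷ (∷²-disjoint (X-Y-disjoint B) ∷ []) ∷ [] ∷ []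
    low : AllPairs Disjoint (switches A′ B′)
    low = (∷²-disjoint (U-V-disjoint A) ∷ A-B-disjoint inj₁ inj₁ ∷ A-B-disjoint inj₁ inj₂ ∷ [])
        ∷ (A-B-disjoint inj₂ inj₁ ∷ A-B-disjoint inj₂ inj₂ ∷ [])
        ∷ (∷²-disjoint (U-V-disjoint B) ∷ []) ∷ [] ∷ []
    padded-high : All (λ c → All (Disjoint c) highs) (List.map pad others)
    padded-high = Allₚ.map⁺ (All.tabulate λ c∈others →
        other-A-disjoint c∈others (X⊆U∪V A) ∷ other-A-disjoint c∈others (Y⊆U∪V A)
      ∷ other-B-disjoint c∈others (X⊆U∪V B) ∷ other-B-disjoint c∈others (Y⊆U∪V B) ∷ [])
    padded-low : All (λ c → All (Disjoint c) (switches A′ B′)) (List.map pad others)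
    padded-low = Allₚ.map⁺ (All.tabulate λ c∈others →
        other-A-disjoint c∈others inj₁ ∷ other-A-disjoint c∈others inj₂
      ∷ other-B-disjoint c∈others inj₁ ∷ other-B-disjoint c∈others inj₂ ∷ [])
    high-low : All (λ c → All (Disjoint c) (switches A′ B′)) highs
    high-low = (clash₁ ∷ clash₁ ∷ A-B-disjoint (X⊆U∪V A) inj₁ ∷ A-B-disjoint (X⊆U∪V A) inj₂ ∷ [])
             ∷ (clash₁ ∷ clash₁ ∷ A-B-disjoint (Y⊆U∪V A) inj₁ ∷ A-B-disjoint (Y⊆U∪V A) inj₂ ∷ [])
             ∷ (B-A-disjoint (X⊆U∪V B) inj₁ ∷ B-A-disjoint (X⊆U∪V B) inj₂ ∷ clash₂ ∷ clash₂ ∷ [])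
             ∷ (B-A-disjoint (Y⊆U∪V B) inj₁ ∷ B-A-disjoint (Y⊆U∪V B) inj₂ ∷ clash₂ ∷ clash₂ ∷ [])
             ∷ []
      where
      clash₁ : ∀ {c s δ δ′} → Disjoint (𝟏 ∷ δ ∷ c) (𝟎 ∷ δ′ ∷ s)
      clash₁ ((false , () , _) ∷ _)
      clash₁ ((true , _ , ()) ∷ _)
      clash₂ : ∀ {c s} → Disjoint (⋆ ∷ 𝟏 ∷ c) (⋆ ∷ 𝟎 ∷ s)
      clash₂ (_ ∷ (false , () , _) ∷ _)
      clash₂ (_ ∷ (true , _ , ()) ∷ _)

  restrict : ∀ {α β s γ δ c} → Saturated F′ (α ∷ β ∷ s) → New (γ ∷ δ ∷ c) →
             Overlap γ α → Overlap δ β → c ⊆ᶜ s ⊎ Disjoint c s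
  restrict sat c oγ oδ = Sum.map (Pointwise.tail ∘ Pointwise.tail) (∷-disjoint⁻ oδ ∘ ∷-disjoint⁻ oγ)
                                 (All.lookup sat (new-∈ c))

  restrict-outside : ∀ {α β s γ δ c} → Saturated F′ (α ∷ β ∷ s) → New (γ ∷ δ ∷ c) →
                     Overlap γ α → Overlap δ β → ¬ (γ ∷ δ ∷ c) ⊆ᶜ (α ∷ β ∷ s) → Disjoint c s
  restrict-outside sat c oγ oδ ¬p =
    ∷-disjoint⁻ oδ (∷-disjoint⁻ oγ (saturated-outside sat (new-∈ c) ¬p))

  A-pair-⊥ : ∀ y {s} → Saturated F′ (bit y ∷ ⋆ ∷ s) → U A ⊆ᶜ s → V A ⊆ᶜ s → ⊥
  A-pair-⊥ y {s} sat u v = two-inside-one-outside irreducible saturated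
      (old-∈ UA) (old-∈ VA) (old-∈ UB) (Disjoint⇒≢ (U-V-disjoint A)) u v (outside UB)
    where
    outside : ∀ {δ c} → New (⋆ ∷ δ ∷ c) → Disjoint c s
    outside c = restrict-outside sat c (⋆-overlap _) (overlap-⋆ _) (⋆⋢bit y ∘ Pointwise.head)
    saturated : Saturated F s
    saturated = Allₚ.++⁺ (All.tabulate (inj₂ ∘ outside ∘ other))
                         (inj₁ u ∷ inj₁ v ∷ inj₂ (outside UB) ∷ inj₂ (outside VB) ∷ [])

  B-pair-⊥ : ∀ z {s} → Saturated F′ (⋆ ∷ bit z ∷ s) → U B ⊆ᶜ s → V B ⊆ᶜ s → ⊥
  B-pair-⊥ z {s} sat u v = two-inside-one-outside irreducible saturated
      (old-∈ UB) (old-∈ VB) (old-∈ UA) (Disjoint⇒≢ (U-V-disjoint B)) u v (outside UA)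
    where
    outside : ∀ {γ c} → New (γ ∷ ⋆ ∷ c) → Disjoint c s
    outside c = restrict-outside sat c (overlap-⋆ _) (⋆-overlap _) (⋆⋢bit z ∘ Pointwise.head ∘ Pointwise.tail)
    saturated : Saturated F s
    saturated = Allₚ.++⁺ (All.tabulate (inj₂ ∘ outside ∘ other))
                         (inj₂ (outside UA) ∷ inj₂ (outside VA) ∷ inj₁ u ∷ inj₁ v ∷ [])

  inside-𝟎 : ∀ {β s c} → New c → c ⊆ᶜ (𝟎 ∷ β ∷ s) → c ≡ 𝟎 ∷ ⋆ ∷ U A ⊎ c ≡ 𝟎 ∷ ⋆ ∷ V A
  inside-𝟎 UA _ = inj₁ refl
  inside-𝟎 VA _ = inj₂ refl
  inside-𝟎 (other _) (() ∷ _)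
  inside-𝟎 XA (() ∷ _)
  inside-𝟎 YA (() ∷ _)
  inside-𝟎 XB (() ∷ _)
  inside-𝟎 YB (() ∷ _)
  inside-𝟎 UB (() ∷ _)
  inside-𝟎 VB (() ∷ _)

  inside-𝟏 : ∀ {β s c} → New c → c ⊆ᶜ (𝟏 ∷ β ∷ s) → c ≡ 𝟏 ∷ ⋆ ∷ X A ⊎ c ≡ 𝟏 ∷ ⋆ ∷ Y A
  inside-𝟏 XA _ = inj₁ refl
  inside-𝟏 YA _ = inj₂ refl
  inside-𝟏 (other _) (() ∷ _)
  inside-𝟏 XB (() ∷ _)
  inside-𝟏 YB (() ∷ _)
  inside-𝟏 UA (() ∷ _)
  inside-𝟏 VA (() ∷ _)
  inside-𝟏 UB (() ∷ _)
  inside-𝟏 VB (() ∷ _)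

  inside-⋆𝟎 : ∀ {s c} → New c → c ⊆ᶜ (⋆ ∷ 𝟎 ∷ s) → c ≡ ⋆ ∷ 𝟎 ∷ U B ⊎ c ≡ ⋆ ∷ 𝟎 ∷ V B
  inside-⋆𝟎 UB _ = inj₁ refl
  inside-⋆𝟎 VB _ = inj₂ refl
  inside-⋆𝟎 (other _) (_ ∷ () ∷ _)
  inside-⋆𝟎 XA (_ ∷ () ∷ _)
  inside-⋆𝟎 YA (_ ∷ () ∷ _)
  inside-⋆𝟎 XB (_ ∷ () ∷ _)
  inside-⋆𝟎 YB (_ ∷ () ∷ _)
  inside-⋆𝟎 UA (_ ∷ () ∷ _)
  inside-⋆𝟎 VA (_ ∷ () ∷ _)

  inside-⋆𝟏 : ∀ {s c} → New c → c ⊆ᶜ (⋆ ∷ 𝟏 ∷ s) → c ≡ ⋆ ∷ 𝟏 ∷ X B ⊎ c ≡ ⋆ ∷ 𝟏 ∷ Y B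
  inside-⋆𝟏 XB _ = inj₁ refl
  inside-⋆𝟏 YB _ = inj₂ refl
  inside-⋆𝟏 (other _) (_ ∷ () ∷ _)
  inside-⋆𝟏 XA (_ ∷ () ∷ _)
  inside-⋆𝟏 YA (_ ∷ () ∷ _)
  inside-⋆𝟏 UA (_ ∷ () ∷ _)
  inside-⋆𝟏 VA (_ ∷ () ∷ _)
  inside-⋆𝟏 UB (_ ∷ () ∷ _)
  inside-⋆𝟏 VB (_ ∷ () ∷ _)

  restrict-⋆⋆ : ∀ {s} → Saturated F′ (⋆ ∷ ⋆ ∷ s) → Saturated F s
  restrict-⋆⋆ sat = All.tabulate λ c∈F →
    restrict sat (proj₂ (proj₂ (lift-old (old c∈F)))) (overlap-⋆ _) (overlap-⋆ _)

  pad-inside : ∀ {s c} → All (_⊆ᶜ s) F → New c → c ⊆ᶜ (⋆ ∷ ⋆ ∷ s)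
  pad-inside all (other c∈others) = ⊑⋆ ∷ ⊑⋆ ∷ All.lookup all (old-∈ (other c∈others))
  pad-inside all XA = ⊑⋆ ∷ ⊑⋆ ∷ ∪-⊆ᶜ (X⊆U∪V A) (All.lookup all (old-∈ UA)) (All.lookup all (old-∈ VA))
  pad-inside all YA = ⊑⋆ ∷ ⊑⋆ ∷ ∪-⊆ᶜ (Y⊆U∪V A) (All.lookup all (old-∈ UA)) (All.lookup all (old-∈ VA))
  pad-inside all XB = ⊑⋆ ∷ ⊑⋆ ∷ ∪-⊆ᶜ (X⊆U∪V B) (All.lookup all (old-∈ UB)) (All.lookup all (old-∈ VB))
  pad-inside all YB = ⊑⋆ ∷ ⊑⋆ ∷ ∪-⊆ᶜ (Y⊆U∪V B) (All.lookup all (old-∈ UB)) (All.lookup all (old-∈ VB))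
  pad-inside all UA = ⊑⋆ ∷ ⊑⋆ ∷ All.lookup all (old-∈ UA)
  pad-inside all VA = ⊑⋆ ∷ ⊑⋆ ∷ All.lookup all (old-∈ VA)
  pad-inside all UB = ⊑⋆ ∷ ⊑⋆ ∷ All.lookup all (old-∈ UB)
  pad-inside all VB = ⊑⋆ ∷ ⊑⋆ ∷ All.lookup all (old-∈ VB)

  A-low-not-both : ∀ {β s} → Saturated F′ (𝟎 ∷ β ∷ s) →
                   ¬ ((𝟎 ∷ ⋆ ∷ U A) ⊆ᶜ (𝟎 ∷ β ∷ s) × (𝟎 ∷ ⋆ ∷ V A) ⊆ᶜ (𝟎 ∷ β ∷ s))
  A-low-not-both sat (_ ∷ ⊑⋆ ∷ u , _ ∷ _ ∷ v) = A-pair-⊥ false sat u v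

  A-high-not-both : ∀ {β s} → Saturated F′ (𝟏 ∷ β ∷ s) →
                    ¬ ((𝟏 ∷ ⋆ ∷ X A) ⊆ᶜ (𝟏 ∷ β ∷ s) × (𝟏 ∷ ⋆ ∷ Y A) ⊆ᶜ (𝟏 ∷ β ∷ s))
  A-high-not-both sat (_ ∷ ⊑⋆ ∷ x , _ ∷ _ ∷ y) = A-pair-⊥ true sat (∪-⊆ᶜ (U⊆X∪Y A) x y) (∪-⊆ᶜ (V⊆X∪Y A) x y)

  B-low-not-both : ∀ {s} → Saturated F′ (⋆ ∷ 𝟎 ∷ s) →
                   ¬ ((⋆ ∷ 𝟎 ∷ U B) ⊆ᶜ (⋆ ∷ 𝟎 ∷ s) × (⋆ ∷ 𝟎 ∷ V B) ⊆ᶜ (⋆ ∷ 𝟎 ∷ s))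
  B-low-not-both sat (_ ∷ _ ∷ u , _ ∷ _ ∷ v) = B-pair-⊥ false sat u v

  B-high-not-both : ∀ {s} → Saturated F′ (⋆ ∷ 𝟏 ∷ s) →
                    ¬ ((⋆ ∷ 𝟏 ∷ X B) ⊆ᶜ (⋆ ∷ 𝟏 ∷ s) × (⋆ ∷ 𝟏 ∷ Y B) ⊆ᶜ (⋆ ∷ 𝟏 ∷ s))
  B-high-not-both sat (_ ∷ _ ∷ x , _ ∷ _ ∷ y) = B-pair-⊥ true sat (∪-⊆ᶜ (U⊆X∪Y B) x y) (∪-⊆ᶜ (V⊆X∪Y B) x y)

  module _ {s} (sat : Saturated F′ (⋆ ∷ ⋆ ∷ s)) (one : AtMostOneInside F s) where
    private
      -- A member built from S inside ⋆ ∷ ⋆ ∷ s would force X S ⊆ s (U and V meet X, and Y ⊆ U),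
      -- and then U S ⊆ s and V S ⊆ s, as X meets U and contains V.
      module Side (S : Switch n) (U∈F : U S ∈ F) (V∈F : V S ∈ F) {γ δ} (X∈F′ : (γ ∷ δ ∷ X S) ∈ F′) where
        X⊈s : ¬ X S ⊆ᶜ s
        X⊈s x with U∩X S
        ... | w , w∈U , w∈X = Disjoint⇒≢ (U-V-disjoint S)
          (one U∈F V∈F (saturated-inside (restrict-⋆⋆ sat) U∈F w∈U (⊆ᶜ-sound x w∈X)) (⊆ᶜ-trans (V⊆X S) x))

        X-meets⇒inside : ∀ {w} → w ∈ᶜ X S → w ∈ᶜ s → X S ⊆ᶜ s
        X-meets⇒inside w∈X w∈s = Pointwise.tail (Pointwise.tail
          (saturated-inside sat X∈F′ (matches-pick γ ∷ matches-pick δ ∷ w∈X) (m⋆ ∷ m⋆ ∷ w∈s)))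

        U⊈s : ¬ U S ⊆ᶜ s
        U⊈s u with U∩X S
        ... | w , w∈U , w∈X = X⊈s (X-meets⇒inside w∈X (⊆ᶜ-sound u w∈U))

        V⊈s : ¬ V S ⊆ᶜ s
        V⊈s v = X⊈s (X-meets⇒inside (⊆ᶜ-sound (V⊆X S) (corner-∈ᶜ _)) (⊆ᶜ-sound v (corner-∈ᶜ _)))

        Y⊈s : ¬ Y S ⊆ᶜ s
        Y⊈s y = U⊈s (saturated-inside (restrict-⋆⋆ sat) U∈F
                       (⊆ᶜ-sound (Y⊆U S) (corner-∈ᶜ _)) (⊆ᶜ-sound y (corner-∈ᶜ _)))

      module SA = Side A (old-∈ UA) (old-∈ VA) (new-∈ XA)
      module SB = Side B (old-∈ UB) (old-∈ VB) (new-∈ XB)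

      inside-⋆⋆ : ∀ {c} → New c → c ⊆ᶜ (⋆ ∷ ⋆ ∷ s) → ∃ λ c′ → c′ ∈ others × c ≡ pad c′
      inside-⋆⋆ (other c∈others) _ = _ , c∈others , refl
      inside-⋆⋆ XA (_ ∷ _ ∷ p) = ⊥-elim (SA.X⊈s p)
      inside-⋆⋆ YA (_ ∷ _ ∷ p) = ⊥-elim (SA.Y⊈s p)
      inside-⋆⋆ UA (_ ∷ _ ∷ p) = ⊥-elim (SA.U⊈s p)
      inside-⋆⋆ VA (_ ∷ _ ∷ p) = ⊥-elim (SA.V⊈s p)
      inside-⋆⋆ XB (_ ∷ _ ∷ p) = ⊥-elim (SB.X⊈s p)
      inside-⋆⋆ YB (_ ∷ _ ∷ p) = ⊥-elim (SB.Y⊈s p)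
      inside-⋆⋆ UB (_ ∷ _ ∷ p) = ⊥-elim (SB.U⊈s p)
      inside-⋆⋆ VB (_ ∷ _ ∷ p) = ⊥-elim (SB.V⊈s p)

    ⋆⋆-at-most-one : AtMostOneInside F′ (⋆ ∷ ⋆ ∷ s)
    ⋆⋆-at-most-one c∈F′ c′∈F′ p p′ with inside-⋆⋆ (new c∈F′) p | inside-⋆⋆ (new c′∈F′) p′
    ... | _ , e∈others , refl | _ , e′∈others , refl = cong pad
      (one (old-∈ (other e∈others)) (old-∈ (other e′∈others))
           (Pointwise.tail (Pointwise.tail p)) (Pointwise.tail (Pointwise.tail p′)))

  irreducible′ : IrreducibleIn F′
  irreducible′ (𝟎 ∷ _ ∷ s) sat = inj₂ (at-most-one-of (λ c∈F′ → inside-𝟎 (new c∈F′)) (A-low-not-both sat))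
  irreducible′ (𝟏 ∷ _ ∷ s) sat = inj₂ (at-most-one-of (λ c∈F′ → inside-𝟏 (new c∈F′)) (A-high-not-both sat))
  irreducible′ (⋆ ∷ 𝟎 ∷ s) sat = inj₂ (at-most-one-of (λ c∈F′ → inside-⋆𝟎 (new c∈F′)) (B-low-not-both sat))
  irreducible′ (⋆ ∷ 𝟏 ∷ s) sat = inj₂ (at-most-one-of (λ c∈F′ → inside-⋆𝟏 (new c∈F′)) (B-high-not-both sat))
  irreducible′ (⋆ ∷ ⋆ ∷ s) sat with irreducible s (restrict-⋆⋆ sat)
  ... | inj₁ all = inj₁ (All.tabulate (pad-inside all ∘ new))
  ... | inj₂ one = inj₂ (⋆⋆-at-most-one sat one)

  lifted : Configuration (suc (suc n)) (suc d)
  lifted = record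
    { others = others′
    ; A      = A′
    ; B      = B′
    ; valid  = record
      { covers      = covers′
      ; disjoint    = disjoint′
      ; irreducible = irreducible′
      ; tight       = tight′
      ; minimal     = lose (new-∈ VA) (cong suc dim-VA)
      ; dim≥        = dim≥′
      }
    ; dim-VA = cong suc dim-VA
    ; dim-XY = dim-XY′
    }
    where
    dim-XY′ : All (λ c → suc d ≤ dim c) (X A′ ∷ Y A′ ∷ X B′ ∷ Y B′ ∷ [])
    dim-XY′ with dim-XY
    ... | xa ∷ ya ∷ xb ∷ yb ∷ [] = s≤s xa ∷ s≤s ya ∷ s≤s xb ∷ s≤s yb ∷ []

-- k * 2 + n rather than 2 * k + n, so that each step adds suc (suc _) definitionally.
iterate : ∀ k {n d} → Configuration n d → Configuration (k * 2 + n) (k + d)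
iterate zero    C = C
iterate (suc k) C = Lift.lifted (iterate k C)

C3 : Configuration 3 0
C3 = record
  { others = (𝟎 ∷ ⋆ ∷ 𝟏 ∷ []) ∷ []
  ; A      = record { base = 𝟏 ∷ 𝟎 ∷ 𝟎 ∷ [] ; i = # 0 ; j = # 2 ; i≢j = λ () ; a = true ; b = false }
  ; B      = record { base = 𝟎 ∷ 𝟏 ∷ 𝟎 ∷ [] ; i = # 2 ; j = # 0 ; i≢j = λ () ; a = false ; b = true }
  ; valid  = certify _ 0
  ; dim-VA = refl
  ; dim-XY = z≤n ∷ z≤n ∷ z≤n ∷ z≤n ∷ []
  }

C6 : Configuration 6 2
C6 = record
  { others = (⋆ ∷ 𝟎 ∷ 𝟎 ∷ 𝟎 ∷ 𝟎 ∷ ⋆ ∷ []) ∷ (⋆ ∷ 𝟏 ∷ 𝟎 ∷ ⋆ ∷ 𝟎 ∷ ⋆ ∷ []) ∷ (⋆ ∷ 𝟏 ∷ 𝟏 ∷ 𝟏 ∷ 𝟎 ∷ ⋆ ∷ []) ∷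
             (𝟎 ∷ 𝟎 ∷ ⋆ ∷ 𝟏 ∷ ⋆ ∷ ⋆ ∷ []) ∷ (𝟎 ∷ 𝟏 ∷ ⋆ ∷ 𝟏 ∷ 𝟏 ∷ ⋆ ∷ []) ∷ (𝟏 ∷ ⋆ ∷ ⋆ ∷ 𝟏 ∷ 𝟏 ∷ ⋆ ∷ []) ∷
             (𝟏 ∷ 𝟎 ∷ ⋆ ∷ 𝟏 ∷ 𝟎 ∷ ⋆ ∷ []) ∷ []
  ; A      = record { base = ⋆ ∷ ⋆ ∷ ⋆ ∷ 𝟎 ∷ 𝟏 ∷ 𝟎 ∷ [] ; i = # 5 ; j = # 2 ; i≢j = λ () ; a = false ; b = false }
  ; B      = record { base = ⋆ ∷ ⋆ ∷ 𝟏 ∷ 𝟎 ∷ ⋆ ∷ 𝟏 ∷ [] ; i = # 5 ; j = # 4 ; i≢j = λ () ; a = true ; b = false }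
  ; valid  = certify _ 2
  ; dim-VA = refl
  ; dim-XY = s≤s (s≤s z≤n) ∷ s≤s (s≤s z≤n) ∷ s≤s (s≤s z≤n) ∷ s≤s (s≤s z≤n) ∷ []
  }

F4 : Family 4
F4 = (⋆ ∷ 𝟎 ∷ ⋆ ∷ 𝟎 ∷ []) ∷ (⋆ ∷ ⋆ ∷ 𝟎 ∷ 𝟏 ∷ []) ∷ (𝟎 ∷ ⋆ ∷ 𝟏 ∷ 𝟏 ∷ []) ∷ (𝟎 ∷ 𝟏 ∷ ⋆ ∷ 𝟎 ∷ []) ∷
     (𝟏 ∷ 𝟎 ∷ 𝟏 ∷ 𝟏 ∷ []) ∷ (𝟏 ∷ 𝟏 ∷ 𝟎 ∷ 𝟎 ∷ []) ∷ (𝟏 ∷ 𝟏 ∷ 𝟏 ∷ ⋆ ∷ []) ∷ []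

F4-valid : TightIrreduciblePartition F4 0
F4-valid = certify F4 0

theorem2p48 : ((k : ℕ) → ∃ λ (F : Family (2 * k + 3)) →
                IsSubcubePartition F × Irreducible F × Tight F × δ≡ F k)
              × (∃ λ (F : Family 4) →
                IsSubcubePartition F × Irreducible F × Tight F × δ≡ F 0)
              × ((k : ℕ) → ∃ λ (F : Family (2 * k + 6)) →
                IsSubcubePartition F × Irreducible F × Tight F × δ≡ F (k + 2))
theorem2p48 =
    (λ k → realise (Configuration.valid
      (subst₂ Configuration (cong (_+ 3) (*-comm k 2)) (+-identityʳ k) (iterate k C3))))
  , realise F4-valid
  , (λ k → realise (Configuration.valid
      (subst (λ m → Configuration m (k + 2)) (cong (_+ 6) (*-comm k 2)) (iterate k C6))))
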